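{- Let $G$ be a graph, $X,Y$ disjoint subsets of $V(G)$, and $K_1,K_2$ two minimal $X$–$Y$ separators. Let $K_1^t=K_1\cap NR(G,Y,K_2)$, $K_1^b=K_1\setminus(K_1^t\cup (K_1\cap K_2))$, $K_2^t=K_2\cap NR(G,Y,K_1)$, $K_2^b=K_2\setminus(K_2^t\cup(K_1\cap K_2))$, and let $Top(K_1,K_2)=K_1^t\cup K_2^t\cup(K_1\cap K_2)$ and $Bottom(K_1,K_2)=K_1^b\cup K_2^b\cup(K_1\cap K_2)$. Then both $Top(K_1,K_2)$ and $Bottom(K_1,K_2)$ are $X$–$Y$ separators. Moreover, $NR(G,Y,Bottom(K_1,K_2))\supseteq NR(G,Y,K_1)$ and $NR(G,Y,Bottom(K_1,K_2))\supseteq NR(G,Y,K_2)$.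
   Context: All graphs are finite, simple and undirected; $G\setminus C$ is the subgraph induced by $V(G)\setminus C$. An $X$–$Y$ separator is a set $K\subseteq V(G)\setminus(X\cup Y)$ such that $G\setminus K$ has no path from a vertex of $X$ to a vertex of $Y$; it is minimal if inclusion-minimal. For disjoint $A,B\subseteq V(G)$, $NR(G,A,B)$ is the set of vertices of $G\setminus B$ not reachable from any vertex of $A$ in $G\setminus B$. (The paper writes $NR(G,Y,K)\supseteq NR(G,Y,K')$ as $K\ge K'$.) -}

module Defs where

open import Level using (0ℓ)
open import Data.Nat using (ℕ)
open import Data.Fin using (Fin)
open import Data.Product using (_×_; Σ-syntax)
open import Data.Sum using (_⊎_)
open import Relation.Nullary using (¬_)
open import Data.Empty using (⊥)
open import Relation.Unary using (Pred; _⊆_; _∩_; _∪_; _∖_; _∈_; _∉_)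

record Graph (n : ℕ) : Set₁ where
  field
    Adj     : Fin n → Fin n → Set
    sym     : ∀ {u v} → Adj u v → Adj v u
    irrefl  : ∀ {u} → ¬ Adj u u

VSet : ℕ → Set₁
VSet n = Pred (Fin n) 0ℓ

module _ {n : ℕ} (G : Graph n) where
  open Graph G

  -- WalkAvoid C u v : a walk from u to v in G \ C (all vertices, endpoints
  -- included, lie outside C).  A path exists iff a walk exists.
  data WalkAvoid (C : VSet n) : Fin n → Fin n → Set where
    here : ∀ {u} → u ∉ C → WalkAvoid C u u
    step : ∀ {u w v} → u ∉ C → Adj u w → WalkAvoid C w v → WalkAvoid C u v

  Reach : VSet n → VSet n → VSet n
  Reach A C v = Σ[ a ∈ Fin n ] (a ∈ A × WalkAvoid C a v)

  NR : VSet n → VSet n → VSet n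
  NR A B v = v ∉ B × ¬ Reach A B v

  Disjoint : VSet n → VSet n → Set
  Disjoint X Y = ∀ {v} → v ∈ X → v ∈ Y → ⊥

  IsSeparator : VSet n → VSet n → VSet n → Set
  IsSeparator X Y K =
    Disjoint K X × Disjoint K Y ×
    (∀ {x y} → x ∈ X → y ∈ Y → ¬ WalkAvoid K x y)

  IsMinimalSeparator : VSet n → VSet n → VSet n → Set₁
  IsMinimalSeparator X Y K =
    IsSeparator X Y K × (∀ (K' : VSet n) → K' ⊆ K → IsSeparator X Y K' → K ⊆ K')

  module _ (Y K₁ K₂ : VSet n) where
    K₁ᵗ K₂ᵗ K₁ᵇ K₂ᵇ Top Bottom : VSet n
    K₁ᵗ = K₁ ∩ NR Y K₂
    K₂ᵗ = K₂ ∩ NR Y K₁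
    K₁ᵇ = K₁ ∖ (K₁ᵗ ∪ (K₁ ∩ K₂))
    K₂ᵇ = K₂ ∖ (K₂ᵗ ∪ (K₁ ∩ K₂))
    Top = K₁ᵗ ∪ K₂ᵗ ∪ (K₁ ∩ K₂)
    Bottom = K₁ᵇ ∪ K₂ᵇ ∪ (K₁ ∩ K₂)

module Submission where

-- Proof idea.  Call a vertex "K-reachable" if a walk from Y reaches it in
-- G \ K.  The whole argument is two invariants propagated along walks:
--
--  * Along a walk in G \ Top that starts in NR(Y,K₁) ∩ NR(Y,K₂), every vertex
--    stays in NR(Y,K₁) ∩ NR(Y,K₂): the next vertex w cannot enter K₁ or K₂
--    alone (it would then lie in K₁ᵗ or K₂ᵗ ⊆ Top) nor both (K₁ ∩ K₂ ⊆ Top).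
--  * Dually, along a walk in G \ Bottom that starts at a vertex which is both
--    K₁- and K₂-reachable, every vertex stays both K₁- and K₂-reachable.
--
-- Membership in K₁, K₂ is not decidable here, so each step is a case split
-- under a double negation; both invariants are instances of one lemma
-- (walk-invariant) about predicates preserved "up to ¬¬" by single edges.
-- Since vertices of X lie in NR(Y,Kᵢ) and vertices of Y are Kᵢ-reachable,
-- the invariants show that Top and Bottom block all X–Y walks, and that no
-- vertex of NR(Y,Kᵢ) can be reached from Y in G \ Bottom.  Top and Bottom
-- lie inside K₁ ∪ K₂, which gives disjointness from X and Y.

open import Defs
open import Data.Nat using (ℕ)
open import Data.Product using (_×_; _,_; proj₂)
open import Data.Sum using (inj₁; inj₂)
open import Relation.Nullary using (¬_; Dec; yes; no)
open import Relation.Nullary.Decidable using (¬¬-excluded-middle)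
open import Relation.Nullary.Negation using (contradiction)
open import Relation.Unary using (_⊆_; _∪_; _∩_; _∈_; _∉_)

by-cases₂ : ∀ {A B C : Set} → (Dec A → Dec B → C) → ¬ ¬ C
by-cases₂ f ¬c = ¬¬-excluded-middle λ a? → ¬¬-excluded-middle λ b? → ¬c (f a? b?)

module Walks {n : ℕ} (G : Graph n) where
  open Graph G

  head∉ : ∀ {C u v} → WalkAvoid G C u v → u ∉ C
  head∉ (here u∉C)     = u∉C
  head∉ (step u∉C _ _) = u∉C

  snoc : ∀ {C u v w} → WalkAvoid G C u v → Adj v w → w ∉ C → WalkAvoid G C u w
  snoc (here u∉C)        vw w∉C = step u∉C vw (here w∉C)
  snoc (step u∉C uu′ W)  vw w∉C = step u∉C uu′ (snoc W vw w∉C)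

  reverse : ∀ {C u v} → WalkAvoid G C u v → WalkAvoid G C v u
  reverse (here u∉C)       = here u∉C
  reverse (step u∉C uw W)  = snoc (reverse W) (sym uw) u∉C

  extend : ∀ {A C v w} → v ∈ Reach G A C → Adj v w → w ∉ C → w ∈ Reach G A C
  extend (a , a∈A , W) vw w∉C = a , a∈A , snoc W vw w∉C

  NR-step : ∀ {A C u w} → u ∈ NR G A C → Adj u w → w ∉ C → w ∈ NR G A C
  NR-step (u∉C , ¬reach-u) uw w∉C = w∉C , λ reach-w → ¬reach-u (extend reach-w (sym uw) u∉C)

  walk-invariant : ∀ {C} (P : VSet n) →
    (∀ {u w} → u ∈ P → Adj u w → w ∉ C → ¬ ¬ (w ∈ P)) →
    ∀ {a b} → WalkAvoid G C a b → a ∈ P → ¬ ¬ (b ∈ P)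
  walk-invariant P preserve (here _)       a∈P ¬b∈P = ¬b∈P a∈P
  walk-invariant P preserve (step _ aw W)  a∈P ¬b∈P =
    preserve a∈P aw (head∉ W) λ w∈P → walk-invariant P preserve W w∈P ¬b∈P

  Y-reachable : ∀ {Y K y} → Disjoint G K Y → y ∈ Y → y ∈ Reach G Y K
  Y-reachable {y = y} K∩Y=∅ y∈Y = y , y∈Y , here (λ y∈K → K∩Y=∅ y∈K y∈Y)

  X-unreachable : ∀ {X Y K x} → IsSeparator G X Y K → x ∈ X → x ∈ NR G Y K
  X-unreachable (K∩X=∅ , _ , separates) x∈X =
    (λ x∈K → K∩X=∅ x∈K x∈X) , λ { (y , y∈Y , W) → separates x∈X y∈Y (reverse W) }

  separator-within-union : ∀ {X Y K₁ K₂ S} →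
    IsSeparator G X Y K₁ → IsSeparator G X Y K₂ → S ⊆ K₁ ∪ K₂ →
    (∀ {x y} → x ∈ X → y ∈ Y → ¬ WalkAvoid G S x y) → IsSeparator G X Y S
  separator-within-union {K₁ = K₁} {K₂ = K₂}
      (K₁∩X=∅ , K₁∩Y=∅ , _) (K₂∩X=∅ , K₂∩Y=∅ , _) S⊆K₁∪K₂ blocks =
    (λ s → missing K₁∩X=∅ K₂∩X=∅ (S⊆K₁∪K₂ s)) ,
    (λ s → missing K₁∩Y=∅ K₂∩Y=∅ (S⊆K₁∪K₂ s)) , blocks
    where
    missing : ∀ {Z v} → Disjoint G K₁ Z → Disjoint G K₂ Z → v ∈ K₁ ∪ K₂ → v ∉ Z
    missing K₁∩Z=∅ _ (inj₁ v∈K₁) = K₁∩Z=∅ v∈K₁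
    missing _ K₂∩Z=∅ (inj₂ v∈K₂) = K₂∩Z=∅ v∈K₂

module TopBottom {n : ℕ} (G : Graph n) (Y K₁ K₂ : VSet n) where
  open Graph G
  open Walks G

  T B : VSet n
  T = Top G Y K₁ K₂
  B = Bottom G Y K₁ K₂

  T⊆K₁∪K₂ : T ⊆ K₁ ∪ K₂
  T⊆K₁∪K₂ (inj₁ (v∈K₁ , _))          = inj₁ v∈K₁
  T⊆K₁∪K₂ (inj₂ (inj₁ (v∈K₂ , _)))   = inj₂ v∈K₂
  T⊆K₁∪K₂ (inj₂ (inj₂ (v∈K₁ , _)))   = inj₁ v∈K₁

  B⊆K₁∪K₂ : B ⊆ K₁ ∪ K₂
  B⊆K₁∪K₂ (inj₁ (v∈K₁ , _))          = inj₁ v∈K₁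
  B⊆K₁∪K₂ (inj₂ (inj₁ (v∈K₂ , _)))   = inj₂ v∈K₂
  B⊆K₁∪K₂ (inj₂ (inj₂ (v∈K₁ , _)))   = inj₁ v∈K₁

  K₁-reachable-in-B : ∀ {v} → v ∈ K₁ → v ∉ K₂ → v ∈ Reach G Y K₂ → v ∈ B
  K₁-reachable-in-B v∈K₁ v∉K₂ reach = inj₁ (v∈K₁ , λ
    { (inj₁ (_ , _ , unreach)) → unreach reach
    ; (inj₂ (_ , v∈K₂))        → v∉K₂ v∈K₂ })

  K₂-reachable-in-B : ∀ {v} → v ∈ K₂ → v ∉ K₁ → v ∈ Reach G Y K₁ → v ∈ B
  K₂-reachable-in-B v∈K₂ v∉K₁ reach = inj₂ (inj₁ (v∈K₂ , λ
    { (inj₁ (_ , _ , unreach)) → unreach reach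
    ; (inj₂ (v∈K₁ , _))        → v∉K₁ v∈K₁ }))

  -- Vertices of NR(Y,Kᵢ) are never in Bottom: they lie outside Kᵢ, and a
  -- vertex of the other separator in NR(Y,Kᵢ) is on the top side.
  NR₁-outside-B : ∀ {v} → v ∈ NR G Y K₁ → v ∉ B
  NR₁-outside-B (v∉K₁ , _) (inj₁ (v∈K₁ , _))               = v∉K₁ v∈K₁
  NR₁-outside-B v∈NR       (inj₂ (inj₁ (v∈K₂ , not-top)))  = not-top (inj₁ (v∈K₂ , v∈NR))
  NR₁-outside-B (v∉K₁ , _) (inj₂ (inj₂ (v∈K₁ , _)))        = v∉K₁ v∈K₁

  NR₂-outside-B : ∀ {v} → v ∈ NR G Y K₂ → v ∉ B
  NR₂-outside-B v∈NR       (inj₁ (v∈K₁ , not-top))         = not-top (inj₁ (v∈K₁ , v∈NR))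
  NR₂-outside-B (v∉K₂ , _) (inj₂ (inj₁ (v∈K₂ , _)))        = v∉K₂ v∈K₂
  NR₂-outside-B (v∉K₂ , _) (inj₂ (inj₂ (_ , v∈K₂)))        = v∉K₂ v∈K₂

  top-step : ∀ {u w} → u ∈ NR G Y K₁ ∩ NR G Y K₂ → Adj u w → w ∉ T →
             ¬ ¬ (w ∈ NR G Y K₁ ∩ NR G Y K₂)
  top-step (u∈NR₁ , u∈NR₂) uw w∉T = by-cases₂ classify
    where
    classify : Dec (_ ∈ K₁) → Dec (_ ∈ K₂) → _ ∈ NR G Y K₁ ∩ NR G Y K₂
    classify (no w∉K₁)  (no w∉K₂)  = NR-step u∈NR₁ uw w∉K₁ , NR-step u∈NR₂ uw w∉K₂
    classify (yes w∈K₁) (no w∉K₂)  = contradiction (inj₁ (w∈K₁ , NR-step u∈NR₂ uw w∉K₂)) w∉T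
    classify (no w∉K₁)  (yes w∈K₂) = contradiction (inj₂ (inj₁ (w∈K₂ , NR-step u∈NR₁ uw w∉K₁))) w∉T
    classify (yes w∈K₁) (yes w∈K₂) = contradiction (inj₂ (inj₂ (w∈K₁ , w∈K₂))) w∉T

  bottom-step : ∀ {u w} → u ∈ Reach G Y K₁ ∩ Reach G Y K₂ → Adj u w → w ∉ B →
                ¬ ¬ (w ∈ Reach G Y K₁ ∩ Reach G Y K₂)
  bottom-step (u-reach₁ , u-reach₂) uw w∉B = by-cases₂ classify
    where
    classify : Dec (_ ∈ K₁) → Dec (_ ∈ K₂) → _ ∈ Reach G Y K₁ ∩ Reach G Y K₂
    classify (no w∉K₁)  (no w∉K₂)  = extend u-reach₁ uw w∉K₁ , extend u-reach₂ uw w∉K₂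
    classify (yes w∈K₁) (no w∉K₂)  =
      contradiction (K₁-reachable-in-B w∈K₁ w∉K₂ (extend u-reach₂ uw w∉K₂)) w∉B
    classify (no w∉K₁)  (yes w∈K₂) =
      contradiction (K₂-reachable-in-B w∈K₂ w∉K₁ (extend u-reach₁ uw w∉K₁)) w∉B
    classify (yes w∈K₁) (yes w∈K₂) = contradiction (inj₂ (inj₂ (w∈K₁ , w∈K₂))) w∉B

  reach-B⇒reach-both : Disjoint G K₁ Y → Disjoint G K₂ Y →
    ∀ {v} → v ∈ Reach G Y B → ¬ ¬ (v ∈ Reach G Y K₁ ∩ Reach G Y K₂)
  reach-B⇒reach-both K₁∩Y=∅ K₂∩Y=∅ (y , y∈Y , W) =
    walk-invariant (Reach G Y K₁ ∩ Reach G Y K₂) bottom-step W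
      (Y-reachable K₁∩Y=∅ y∈Y , Y-reachable K₂∩Y=∅ y∈Y)

  -- Top blocks every X–Y walk: X starts in NR(Y,K₁) ∩ NR(Y,K₂), Y does not.
  top-blocks : ∀ {X} → IsSeparator G X Y K₁ → IsSeparator G X Y K₂ →
    ∀ {x y} → x ∈ X → y ∈ Y → ¬ WalkAvoid G T x y
  top-blocks sep₁@(_ , K₁∩Y=∅ , _) sep₂ x∈X y∈Y W =
    walk-invariant (NR G Y K₁ ∩ NR G Y K₂) top-step W
      (X-unreachable sep₁ x∈X , X-unreachable sep₂ x∈X)
      λ { ((_ , unreach) , _) → unreach (Y-reachable K₁∩Y=∅ y∈Y) }

  -- Bottom blocks every X–Y walk: otherwise X would be K₁-reachable.
  bottom-blocks : ∀ {X} → IsSeparator G X Y K₁ → IsSeparator G X Y K₂ →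
    ∀ {x y} → x ∈ X → y ∈ Y → ¬ WalkAvoid G B x y
  bottom-blocks sep₁@(_ , K₁∩Y=∅ , _) (_ , K₂∩Y=∅ , _) {y = y} x∈X y∈Y W =
    reach-B⇒reach-both K₁∩Y=∅ K₂∩Y=∅ (y , y∈Y , reverse W)
      λ { (reach₁ , _) → proj₂ (X-unreachable sep₁ x∈X) reach₁ }

  NR₁⊆NR-B : Disjoint G K₁ Y → Disjoint G K₂ Y → NR G Y K₁ ⊆ NR G Y B
  NR₁⊆NR-B K₁∩Y=∅ K₂∩Y=∅ v∈NR₁@(_ , unreach₁) =
    NR₁-outside-B v∈NR₁ ,
    λ reach → reach-B⇒reach-both K₁∩Y=∅ K₂∩Y=∅ reach λ { (reach₁ , _) → unreach₁ reach₁ }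

  NR₂⊆NR-B : Disjoint G K₁ Y → Disjoint G K₂ Y → NR G Y K₂ ⊆ NR G Y B
  NR₂⊆NR-B K₁∩Y=∅ K₂∩Y=∅ v∈NR₂@(_ , unreach₂) =
    NR₂-outside-B v∈NR₂ ,
    λ reach → reach-B⇒reach-both K₁∩Y=∅ K₂∩Y=∅ reach λ { (_ , reach₂) → unreach₂ reach₂ }

proposition2 : ∀ {n : ℕ} (G : Graph n) (X Y K₁ K₂ : VSet n) →
    Disjoint G X Y →
    IsMinimalSeparator G X Y K₁ →
    IsMinimalSeparator G X Y K₂ →
    IsSeparator G X Y (Top G Y K₁ K₂) ×
    IsSeparator G X Y (Bottom G Y K₁ K₂) ×
    NR G Y K₁ ⊆ NR G Y (Bottom G Y K₁ K₂) ×
    NR G Y K₂ ⊆ NR G Y (Bottom G Y K₁ K₂)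
proposition2 G X Y K₁ K₂ _ (sep₁@(_ , K₁∩Y=∅ , _) , _) (sep₂@(_ , K₂∩Y=∅ , _) , _) =
  separator-within-union sep₁ sep₂ T⊆K₁∪K₂ (top-blocks sep₁ sep₂) ,
  separator-within-union sep₁ sep₂ B⊆K₁∪K₂ (bottom-blocks sep₁ sep₂) ,
  NR₁⊆NR-B K₁∩Y=∅ K₂∩Y=∅ ,
  NR₂⊆NR-B K₁∩Y=∅ K₂∩Y=∅
  where
  open Walks G
  open TopBottom G Y K₁ K₂
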